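{- Let $G$ be a finite simple graph that is $(P_2\cup P_4)$-free and butterfly-free. Then $\chi(G)\le \frac{\omega(G)^2+3\omega(G)-2}{2}$.
   Context: $P_t$ denotes the path on $t$ vertices. For vertex-disjoint graphs $G_1,G_2$, $G_1\cup G_2$ is their disjoint union (no edges between them). A graph $G$ is $H$-free if no induced subgraph of $G$ is isomorphic to $H$. A butterfly is the graph consisting of two triangles sharing exactly one vertex. $\chi(G)$ is the chromatic number and $\omega(G)$ the clique number of $G$. -}

module Defs where

open import Data.Nat using (ℕ; zero; suc; _+_; _*_; _≤_; _<_)
open import Data.Fin using (Fin; toℕ)
open import Data.Bool using (Bool; true; false; _∨_)
open import Data.Product using (Σ; ∃; _×_; _,_)
open import Relation.Binary.PropositionalEquality using (_≡_; _≢_)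
open import Function.Definitions using (Injective)

record Graph (n : ℕ) : Set where
  field
    adj    : Fin n → Fin n → Bool
    sym    : ∀ u v → adj u v ≡ adj v u
    irrefl : ∀ v → adj v v ≡ false
open Graph public

InducedCopy : ∀ {k n} → Graph k → Graph n → Set
InducedCopy {k} {n} H G =
  Σ (Fin k → Fin n) λ f →
    Injective _≡_ _≡_ f × (∀ i j → adj G (f i) (f j) ≡ adj H i j)

Free : ∀ {k n} → Graph k → Graph n → Set
Free H G = InducedCopy H G → ⊥'
  where open import Data.Empty renaming (⊥ to ⊥')

p2p4Edge : ℕ → ℕ → Bool
p2p4Edge 0 1 = true
p2p4Edge 2 3 = true
p2p4Edge 3 4 = true
p2p4Edge 4 5 = true
p2p4Edge _ _ = false

butterflyEdge : ℕ → ℕ → Bool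
butterflyEdge 0 1 = true
butterflyEdge 0 2 = true
butterflyEdge 1 2 = true
butterflyEdge 0 3 = true
butterflyEdge 0 4 = true
butterflyEdge 3 4 = true
butterflyEdge _ _ = false

P2∪P4 : Graph 6
P2∪P4 = record { adj = λ i j → p2p4Edge (toℕ i) (toℕ j) ∨ p2p4Edge (toℕ j) (toℕ i)
               ; sym = sy ; irrefl = ir }
  where
  open import Data.Bool.Properties using (∨-comm)
  sy : ∀ u v → _
  sy u v = ∨-comm (p2p4Edge (toℕ u) (toℕ v)) (p2p4Edge (toℕ v) (toℕ u))
  ir : ∀ v → p2p4Edge (toℕ v) (toℕ v) ∨ p2p4Edge (toℕ v) (toℕ v) ≡ false
  ir Fin.zero = _≡_.refl
  ir (Fin.suc Fin.zero) = _≡_.refl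
  ir (Fin.suc (Fin.suc Fin.zero)) = _≡_.refl
  ir (Fin.suc (Fin.suc (Fin.suc Fin.zero))) = _≡_.refl
  ir (Fin.suc (Fin.suc (Fin.suc (Fin.suc Fin.zero)))) = _≡_.refl
  ir (Fin.suc (Fin.suc (Fin.suc (Fin.suc (Fin.suc Fin.zero))))) = _≡_.refl

Butterfly : Graph 5
Butterfly = record { adj = λ i j → butterflyEdge (toℕ i) (toℕ j) ∨ butterflyEdge (toℕ j) (toℕ i)
                   ; sym = sy ; irrefl = ir }
  where
  open import Data.Bool.Properties using (∨-comm)
  sy : ∀ u v → _
  sy u v = ∨-comm (butterflyEdge (toℕ u) (toℕ v)) (butterflyEdge (toℕ v) (toℕ u))
  ir : ∀ v → butterflyEdge (toℕ v) (toℕ v) ∨ butterflyEdge (toℕ v) (toℕ v) ≡ false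
  ir Fin.zero = _≡_.refl
  ir (Fin.suc Fin.zero) = _≡_.refl
  ir (Fin.suc (Fin.suc Fin.zero)) = _≡_.refl
  ir (Fin.suc (Fin.suc (Fin.suc Fin.zero))) = _≡_.refl
  ir (Fin.suc (Fin.suc (Fin.suc (Fin.suc Fin.zero)))) = _≡_.refl

Clique : ∀ {n} → Graph n → ℕ → Set
Clique {n} G k =
  Σ (Fin k → Fin n) λ f →
    Injective _≡_ _≡_ f × (∀ i j → i ≢ j → adj G (f i) (f j) ≡ true)

IsCliqueNumber : ∀ {n} → Graph n → ℕ → Set
IsCliqueNumber G w = Clique G w × (∀ k → Clique G k → k ≤ w)

Colouring : ∀ {n} → Graph n → ℕ → Set
Colouring {n} G k =
  Σ (Fin n → Fin k) λ c → ∀ u v → adj G u v ≡ true → c u ≢ c v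

IsChromaticNumber : ∀ {n} → Graph n → ℕ → Set
IsChromaticNumber G c = Colouring G c × (∀ k → Colouring G k → c ≤ k)

-- Fix a maximum clique f₀ … f_{ω-1} with ω ≥ 2. The set S of vertices missing both f₀ and
-- f₁ is P₄-free, since an induced P₄ in S together with the edge f₀f₁ would be an induced
-- P₂ ∪ P₄; and any greedy colouring of a P₄-free graph is optimal, because a vertex of
-- colour c lies in a clique with one vertex of each colour 0 … c. A vertex outside S misses
-- some fᵢ, as f is maximum. If it misses only fᵢ it gets colour (i, i), otherwise colour
-- (i, j) where fᵢ, fⱼ are the first two clique vertices it misses. Adjacent u, w missing
-- only fᵢ would give the (ω+1)-clique u, w, (f_k)_{k≠i}, and adjacent u, w with first misses
-- (i, j) would form a butterfly with fᵢ, fⱼ and some f_k, k < j, seen by both.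
-- Counting the pairs (i, j) and the colours of S, sharing one colour, gives
-- ω(ω+1)/2 + ω − 1 colours.

module Submission where

open import Defs hiding (sym)
open import Data.Nat using (ℕ; zero; suc; _+_; _*_; _≤_; _<_; z≤n; s≤s; _≤?_)
open import Data.Nat.Properties
  using ( ≤-refl; ≤-trans; <-irrefl; <-cmp; <⇒≤; <⇒≢; <-≤-trans; ≤-<-trans; ≤∧≢⇒<; ≰⇒>; 1+n≰n
        ; 0≢1+n; m≤m+n; m<1+n⇒m<n∨m≡n; +-suc; +-comm; +-cancelˡ-≡; +-mono-≤; +-monoˡ-≤; +-monoʳ-<
        ; *-monoʳ-≤; *-distribˡ-+ )
open import Data.Nat.Tactic.RingSolver using (solve-∀)
open import Data.Fin using (Fin; zero; suc; toℕ; fromℕ<)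
open import Data.Fin.Patterns using (0F; 1F; 2F; 3F; 4F; 5F)
open import Data.Fin.Properties
  using (all?; any?; ¬∀⟶∃¬; suc-injective; toℕ-injective; toℕ-fromℕ<; toℕ<n)
  renaming (_≟_ to _≟ᶠ_; <⇒≢ to <⇒≢ᶠ)
open import Data.Bool using (true; false)
open import Data.Bool.Properties using (¬-not) renaming (_≟_ to _≟ᵇ_)
open import Data.Product using (∃; _,_; proj₁; proj₂; _×_)
open import Data.Sum using (_⊎_; inj₁; inj₂; [_,_]′)
open import Data.Empty using (⊥; ⊥-elim)
open import Data.List using (List; []; _∷_; map; filter; allFin)
open import Data.List.Extrema.Nat using (max; xs≤max)
open import Data.List.Membership.Propositional using (_∈_; _∉_)
open import Data.List.Relation.Unary.Any using (here; there)
open import Data.List.Membership.Propositional.Properties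
  using (∈-allFin; ∈-map⁺; ∈-map⁻; ∈-filter⁺; ∈-filter⁻)
open import Data.List.Membership.DecPropositional Data.Nat._≟_ using (_∈?_)
open import Data.List.Relation.Unary.All as All using ()
open import Data.Vec.Functional as Vector using (Vector; updateAt)
open import Data.Vec.Functional.Properties using (updateAt-updates; updateAt-minimal)
open import Function using (_∘_; const)
open import Relation.Nullary using (¬_; Dec; yes; no; contradiction)
open import Relation.Nullary.Decidable using (_⊎-dec_; _×-dec_; ¬?; toWitness)
open import Relation.Unary using (Decidable)
open import Relation.Binary.PropositionalEquality
open import Relation.Binary.Definitions using (tri<; tri≈; tri>)

module Adjacency {n : ℕ} (G : Graph n) where

  infix 4 _~_ _≁_ _~?_

  _~_ : Fin n → Fin n → Set
  u ~ v = adj G u v ≡ true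

  _≁_ : Fin n → Fin n → Set
  u ≁ v = adj G u v ≡ false

  _~?_ : ∀ u v → Dec (u ~ v)
  u ~? v = adj G u v ≟ᵇ true

  ~-sym : ∀ {u v} → u ~ v → v ~ u
  ~-sym {u} {v} = trans (Graph.sym G v u)

  ≁-sym : ∀ {u v} → u ≁ v → v ≁ u
  ≁-sym {u} {v} = trans (Graph.sym G v u)

  ¬~⇒≁ : ∀ {u v} → ¬ u ~ v → u ≁ v
  ¬~⇒≁ = ¬-not

  ~⇒≢ : ∀ {u v} → u ~ v → u ≢ v
  ~⇒≢ {u} u~u refl with trans (sym u~u) (irrefl G u)
  ... | ()

  IsClique : ∀ {k} → Vector (Fin n) k → Set
  IsClique q = ∀ i j → i ≢ j → q i ~ q j

  toClique : ∀ {k} {q : Vector (Fin n) k} → IsClique q → Clique G k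
  toClique {q = q} q-clique = q , injective , q-clique
    where
    injective : ∀ {i j} → q i ≡ q j → i ≡ j
    injective {i} {j} qi≡qj with i ≟ᶠ j
    ... | yes i≡j = i≡j
    ... | no i≢j = contradiction qi≡qj (~⇒≢ (q-clique i j i≢j))

  singleton-isClique : ∀ u → IsClique (u Vector.∷ Vector.[])
  singleton-isClique u 0F 0F 0≢0 = contradiction refl 0≢0

  ∷-isClique : ∀ {k u} {q : Vector (Fin n) k} → IsClique q → (∀ i → u ~ q i) →
               IsClique (u Vector.∷ q)
  ∷-isClique q-clique u~q 0F      0F      0≢0 = contradiction refl 0≢0
  ∷-isClique q-clique u~q 0F      (suc j) _   = u~q j
  ∷-isClique q-clique u~q (suc i) 0F      _   = ~-sym (u~q i)
  ∷-isClique q-clique u~q (suc i) (suc j) i≢j = q-clique i j (i≢j ∘ cong suc)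

  tail-isClique : ∀ {k} {q : Vector (Fin n) (suc k)} → IsClique q → IsClique (Vector.tail q)
  tail-isClique q-clique i j i≢j = q-clique (suc i) (suc j) (i≢j ∘ suc-injective)

  updateAt-isClique : ∀ {k w} {q : Vector (Fin n) k} (i : Fin k) → IsClique q →
                      (∀ j → j ≢ i → w ~ q j) → IsClique (updateAt q i (const w))
  updateAt-isClique {w = w} {q} i q-clique w~q j l j≢l with j ≟ᶠ i | l ≟ᶠ i
  ... | yes refl | yes refl = contradiction refl j≢l
  ... | yes refl | no l≢i
    rewrite updateAt-updates i {const w} q | updateAt-minimal l i {const w} q l≢i = w~q l l≢i
  ... | no j≢i | yes refl
    rewrite updateAt-minimal j i {const w} q j≢i | updateAt-updates i {const w} q = ~-sym (w~q j j≢i)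
  ... | no j≢i | no l≢i
    rewrite updateAt-minimal j i {const w} q j≢i | updateAt-minimal l i {const w} q l≢i = q-clique j l j≢l

  InducedP₄ : Fin n → Fin n → Fin n → Fin n → Set
  InducedP₄ a b c d = a ~ b × b ~ c × c ~ d × a ≁ c × a ≁ d × b ≁ d

DistinctNeighbourhoods : ∀ {k} → Graph k → Set
DistinctNeighbourhoods {k} H = ∀ i j → i ≡ j ⊎ ∃ λ l → adj H i l ≢ adj H j l

distinctNeighbourhoods? : ∀ {k} (H : Graph k) → Dec (DistinctNeighbourhoods H)
distinctNeighbourhoods? H =
  all? λ i → all? λ j → (i ≟ᶠ j) ⊎-dec any? (λ l → ¬? (adj H i l ≟ᵇ adj H j l))

inducedCopy : ∀ {k n} {H : Graph k} {G : Graph n} → DistinctNeighbourhoods H →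
              (g : Fin k → Fin n) → (∀ i j → adj G (g i) (g j) ≡ adj H i j) → InducedCopy H G
inducedCopy {G = G} distinct g preserves = g , injective , preserves
  where
  injective : ∀ {i j} → g i ≡ g j → i ≡ j
  injective {i} {j} gi≡gj with distinct i j
  ... | inj₁ i≡j = i≡j
  ... | inj₂ (l , differ) = ⊥-elim (
    differ (trans (sym (preserves i l)) (trans (cong (λ x → adj G x (g l)) gi≡gj) (preserves j l))))

butterfly-distinct : DistinctNeighbourhoods Butterfly
butterfly-distinct = toWitness {a? = distinctNeighbourhoods? Butterfly} _

P₂∪P₄-distinct : DistinctNeighbourhoods P2∪P4
P₂∪P₄-distinct = toWitness {a? = distinctNeighbourhoods? P2∪P4} _

module _ {n : ℕ} (G : Graph n) where
  open Adjacency G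

  ¬-induced-butterfly : Free Butterfly G → ∀ {c x y p q} →
    c ~ x → c ~ y → x ~ y → c ~ p → c ~ q → p ~ q → x ≁ p → x ≁ q → y ≁ p → y ≁ q → ⊥
  ¬-induced-butterfly butterfly-free {c} {x} {y} {p} {q} cx cy xy cp cq pq xp xq yp yq =
    butterfly-free (inducedCopy {H = Butterfly} {G = G} butterfly-distinct g preserves)
    where
    g : Fin 5 → Fin n
    g 0F = c
    g 1F = x
    g 2F = y
    g 3F = p
    g 4F = q
    preserves : ∀ i j → adj G (g i) (g j) ≡ adj Butterfly i j
    preserves = λ
      { 0F 0F → irrefl G c ; 0F 1F → cx         ; 0F 2F → cy         ; 0F 3F → cp         ; 0F 4F → cq
      ; 1F 0F → ~-sym cx   ; 1F 1F → irrefl G x ; 1F 2F → xy         ; 1F 3F → xp         ; 1F 4F → xq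
      ; 2F 0F → ~-sym cy   ; 2F 1F → ~-sym xy   ; 2F 2F → irrefl G y ; 2F 3F → yp         ; 2F 4F → yq
      ; 3F 0F → ~-sym cp   ; 3F 1F → ≁-sym xp   ; 3F 2F → ≁-sym yp   ; 3F 3F → irrefl G p ; 3F 4F → pq
      ; 4F 0F → ~-sym cq   ; 4F 1F → ≁-sym xq   ; 4F 2F → ≁-sym yq   ; 4F 3F → ~-sym pq   ; 4F 4F → irrefl G q
      }

  P₄-free-off-edge : Free P2∪P4 G → ∀ {s t} → s ~ t → {N : Fin n → Set} →
    (∀ {x} → N x → x ≁ s × x ≁ t) →
    ∀ {a b c d} → N a → N b → N c → N d → ¬ InducedP₄ a b c d
  P₄-free-off-edge P₂∪P₄-free {s} {t} st off {a} {b} {c} {d} Na Nb Nc Nd (ab , bc , cd , ac , ad , bd)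
    with off Na | off Nb | off Nc | off Nd
  ... | as , at | bs , bt | cs , ct | ds , dt =
    P₂∪P₄-free (inducedCopy {H = P2∪P4} {G = G} P₂∪P₄-distinct g preserves)
    where
    g : Fin 6 → Fin n
    g 0F = s
    g 1F = t
    g 2F = a
    g 3F = b
    g 4F = c
    g 5F = d
    preserves : ∀ i j → adj G (g i) (g j) ≡ adj P2∪P4 i j
    preserves = λ
      { 0F 0F → irrefl G s ; 0F 1F → st         ; 0F 2F → ≁-sym as   ; 0F 3F → ≁-sym bs
                                                   ; 0F 4F → ≁-sym cs   ; 0F 5F → ≁-sym ds
      ; 1F 0F → ~-sym st   ; 1F 1F → irrefl G t ; 1F 2F → ≁-sym at   ; 1F 3F → ≁-sym bt
                                                   ; 1F 4F → ≁-sym ct   ; 1F 5F → ≁-sym dt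
      ; 2F 0F → as         ; 2F 1F → at         ; 2F 2F → irrefl G a ; 2F 3F → ab
                                                   ; 2F 4F → ac         ; 2F 5F → ad
      ; 3F 0F → bs         ; 3F 1F → bt         ; 3F 2F → ~-sym ab   ; 3F 3F → irrefl G b
                                                   ; 3F 4F → bc         ; 3F 5F → bd
      ; 4F 0F → cs         ; 4F 1F → ct         ; 4F 2F → ≁-sym ac   ; 4F 3F → ~-sym bc
                                                   ; 4F 4F → irrefl G c ; 4F 5F → cd
      ; 5F 0F → ds         ; 5F 1F → dt         ; 5F 2F → ≁-sym ad   ; 5F 3F → ≁-sym bd
                                                   ; 5F 4F → ~-sym cd   ; 5F 5F → irrefl G d
      }

least-failure : ∀ {W} {P : Fin W → Set} → Decidable P →
                (∃ λ i → ¬ P i × (∀ k → toℕ k < toℕ i → P k)) ⊎ (∀ k → P k)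
least-failure {zero} P? = inj₂ λ ()
least-failure {suc W} P? with P? 0F
... | no ¬P0 = inj₁ (0F , ¬P0 , λ _ ())
... | yes P0 with least-failure (P? ∘ suc)
...   | inj₂ P-rest = inj₂ λ { 0F → P0 ; (suc k) → P-rest k }
...   | inj₁ (i , ¬Pi , below) =
  inj₁ (suc i , ¬Pi , λ { 0F _ → P0 ; (suc k) (s≤s k<i) → below k k<i })

least-failureℕ : ∀ {P : ℕ → Set} → Decidable P → ∀ B →
                 (∃ λ t → ¬ P t × (∀ {s} → s < t → P s)) ⊎ (∀ {s} → s < B → P s)
least-failureℕ P? zero = inj₂ λ ()
least-failureℕ P? (suc B) with least-failureℕ P? B
... | inj₁ found = inj₁ found
... | inj₂ below with P? B
...   | no ¬PB = inj₁ (B , ¬PB , below)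
...   | yes PB = inj₂ λ s<1+B → [ below , (λ { refl → PB }) ]′ (m<1+n⇒m<n∨m≡n s<1+B)

mex : (cs : List ℕ) → ∃ λ t → t ∉ cs × (∀ {s} → s < t → s ∈ cs)
mex cs with least-failureℕ (_∈? cs) (suc (suc (max 0 cs)))
... | inj₁ found = found
... | inj₂ below = contradiction (All.lookup (xs≤max 0 cs) (below ≤-refl)) 1+n≰n

module Greedy {n : ℕ} (G : Graph n) {S : Fin n → Set} (S? : Decidable S)
  (P₄-free : ∀ {a b c d} → S a → S b → S c → S d → ¬ Adjacency.InducedP₄ G a b c d) where

  open Adjacency G

  neighbourColours : Fin n → List (Fin n × ℕ) → List ℕ
  neighbourColours x = map proj₂ ∘ filter (λ yc → x ~? proj₁ yc)

  neighbourColours⁺ : ∀ {x y c} L → (y , c) ∈ L → x ~ y → c ∈ neighbourColours x L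
  neighbourColours⁺ {x} L yc∈L x~y = ∈-map⁺ proj₂ (∈-filter⁺ (λ yc → x ~? proj₁ yc) yc∈L x~y)

  neighbourColours⁻ : ∀ {x c} L → c ∈ neighbourColours x L → ∃ λ y → (y , c) ∈ L × x ~ y
  neighbourColours⁻ {x} L c∈ with ∈-map⁻ proj₂ c∈
  ... | (y , c) , yc∈ , refl with ∈-filter⁻ (λ yc → x ~? proj₁ yc) yc∈
  ...   | yc∈L , x~y = y , yc∈L , x~y

  greedy : List (Fin n) → List (Fin n × ℕ)
  greedy [] = []
  greedy (x ∷ xs) = (x , proj₁ (mex (neighbourColours x (greedy xs)))) ∷ greedy xs

  greedy-proper : ∀ xs {y c y′ c′} → (y , c) ∈ greedy xs → (y′ , c′) ∈ greedy xs →
                  y ~ y′ → c ≢ c′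
  greedy-proper (x ∷ xs) (here refl) (here refl) x~x _    = ~⇒≢ x~x refl
  greedy-proper (x ∷ xs) (here refl) (there q)   x~y refl =
    proj₁ (proj₂ (mex _)) (neighbourColours⁺ (greedy xs) q x~y)
  greedy-proper (x ∷ xs) (there p)   (here refl) y~x refl =
    proj₁ (proj₂ (mex _)) (neighbourColours⁺ (greedy xs) p (~-sym y~x))
  greedy-proper (x ∷ xs) (there p)   (there q)   y~y′ = greedy-proper xs p q y~y′

  greedy-mex : ∀ xs {y c t} → (y , c) ∈ greedy xs → t < c →
               ∃ λ y′ → (y′ , t) ∈ greedy xs × y ~ y′
  greedy-mex (x ∷ xs) (here refl) t<c with neighbourColours⁻ (greedy xs) (proj₂ (proj₂ (mex _)) t<c)
  ... | y′ , y′t∈ , x~y′ = y′ , there y′t∈ , x~y′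
  greedy-mex (x ∷ xs) (there p) t<c with greedy-mex xs p t<c
  ... | y′ , y′t∈ , y~y′ = y′ , there y′t∈ , y~y′

  greedy-colours : ∀ xs {x} → x ∈ xs → ∃ λ c → (x , c) ∈ greedy xs
  greedy-colours (x ∷ xs) (here refl) = _ , here refl
  greedy-colours (x ∷ xs) (there p) with greedy-colours xs p
  ... | c , xc∈ = c , there xc∈

  greedy-domain : ∀ xs {y c} → (y , c) ∈ greedy xs → y ∈ xs
  greedy-domain (x ∷ xs) (here refl) = here refl
  greedy-domain (x ∷ xs) (there p) = there (greedy-domain xs p)

  S-colouring : List (Fin n × ℕ)
  S-colouring = greedy (filter S? (allFin n))

  coloured⇒S : ∀ {y c} → (y , c) ∈ S-colouring → S y
  coloured⇒S p = proj₂ (∈-filter⁻ S? {xs = allFin n} (greedy-domain (filter S? (allFin n)) p))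

  same-colour⇒≁ : ∀ {z z′ c} → (z , c) ∈ S-colouring → (z′ , c) ∈ S-colouring → z ≁ z′
  same-colour⇒≁ p p′ = ¬~⇒≁ λ z~z′ → greedy-proper _ p p′ z~z′ refl

  -- If q₀'s colour-c neighbour z misses some qᵢ, then z q₀ qᵢ z′ is an induced P₄,
  -- as vertices of equal colour are non-adjacent.
  common-neighbour : ∀ {k} c (q : Vector (Fin n) (suc k)) → IsClique q → (∀ i → S (q i)) →
    (∀ i → ∃ λ z → (z , c) ∈ S-colouring × q i ~ z) →
    ∃ λ z → (z , c) ∈ S-colouring × (∀ i → q i ~ z)
  common-neighbour {zero} c q _ _ neighbour with neighbour 0F
  ... | z , zc∈ , q₀~z = z , zc∈ , λ { 0F → q₀~z }
  common-neighbour {suc k} c q q-clique q-S neighbour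
    with common-neighbour c (Vector.tail q) (tail-isClique q-clique) (q-S ∘ suc) (neighbour ∘ suc)
  ... | z′ , z′c∈ , tail~z′ with q 0F ~? z′
  ...   | yes q₀~z′ = z′ , z′c∈ , λ { 0F → q₀~z′ ; (suc i) → tail~z′ i }
  ...   | no ¬q₀~z′ with neighbour 0F
  ...     | z , zc∈ , q₀~z with all? (λ i → q (suc i) ~? z)
  ...       | yes tail~z = z , zc∈ , λ { 0F → q₀~z ; (suc i) → tail~z i }
  ...       | no ¬tail~z with ¬∀⟶∃¬ _ _ (λ i → q (suc i) ~? z) ¬tail~z
  ...         | i , ¬qᵢ~z = ⊥-elim (P₄-free (coloured⇒S zc∈) (q-S 0F) (q-S (suc i)) (coloured⇒S z′c∈)
    ( ~-sym q₀~z , q-clique 0F (suc i) (λ ()) , tail~z′ i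
    , ≁-sym (¬~⇒≁ ¬qᵢ~z) , same-colour⇒≁ zc∈ z′c∈ , ¬~⇒≁ ¬q₀~z′ ))

  coloured-clique : ∀ {l} k (q : Vector (Fin n) (suc l)) → IsClique q →
    (∀ i → ∃ λ c → (q i , c) ∈ S-colouring × k ≤ c) → Clique G (k + suc l)
  coloured-clique zero q q-clique _ = toClique q-clique
  coloured-clique {l} (suc k) q q-clique coloured
    with common-neighbour k q q-clique (λ i → coloured⇒S (proj₁ (proj₂ (coloured i)))) lower-neighbour
    where
    lower-neighbour : ∀ i → ∃ λ z → (z , k) ∈ S-colouring × q i ~ z
    lower-neighbour i with coloured i
    ... | c , qc∈ , k<c = greedy-mex _ qc∈ k<c
  ... | z , zk∈ , q~z = subst (Clique G) (+-suc k (suc l))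
    (coloured-clique k (z Vector.∷ q) (∷-isClique q-clique (~-sym ∘ q~z)) λ
      { 0F → k , zk∈ , ≤-refl
      ; (suc i) → let c , qc∈ , k<c = coloured i in c , qc∈ , <⇒≤ k<c })

  colour-< : ∀ {ω} → (∀ k → Clique G k → k ≤ ω) → ∀ {y c} → (y , c) ∈ S-colouring → c < ω
  colour-< {ω} maxω {y} {c} yc∈ = subst (_≤ ω) (+-comm c 1)
    (maxω _ (coloured-clique c (y Vector.∷ Vector.[]) (singleton-isClique y)
                              λ { 0F → c , yc∈ , ≤-refl }))

  colour : ∀ u → S u → ℕ
  colour u Su = proj₁ (greedy-colours _ (∈-filter⁺ S? (∈-allFin u) Su))

  colour-∈ : ∀ u Su → (u , colour u Su) ∈ S-colouring
  colour-∈ u Su = proj₂ (greedy-colours _ (∈-filter⁺ S? (∈-allFin u) Su))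

  colour-proper : ∀ {u w} Su Sw → u ~ w → colour u Su ≢ colour w Sw
  colour-proper {u} {w} Su Sw = greedy-proper _ (colour-∈ u Su) (colour-∈ w Sw)

triangle : ℕ → ℕ
triangle zero = 0
triangle (suc m) = triangle m + suc m

triangle-mono : ∀ {a b} → a ≤ b → triangle a ≤ triangle b
triangle-mono {zero} _ = z≤n
triangle-mono {suc a} {suc b} (s≤s a≤b) = +-mono-≤ (triangle-mono a≤b) (s≤s a≤b)

double-triangle : ∀ m → 2 * triangle m ≡ m * m + m
double-triangle zero = refl
double-triangle (suc m) = begin
  2 * (triangle m + suc m)      ≡⟨ *-distribˡ-+ 2 (triangle m) (suc m) ⟩
  2 * triangle m + 2 * suc m    ≡⟨ cong (_+ 2 * suc m) (double-triangle m) ⟩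
  m * m + m + 2 * suc m         ≡⟨ square-step m ⟩
  suc m * suc m + suc m         ∎
  where
  open ≡-Reasoning
  square-step : ∀ m → m * m + m + 2 * suc m ≡ suc m * suc m + suc m
  square-step = solve-∀

pairCode : ℕ → ℕ → ℕ
pairCode a b = triangle b + a

pairCode-< : ∀ {a b W} → a ≤ b → b < W → pairCode a b < triangle W
pairCode-< {a} {b} a≤b b<W = ≤-trans (+-monoʳ-< (triangle b) (s≤s a≤b)) (triangle-mono b<W)

pairCode-injective : ∀ {a b a′ b′} → a ≤ b → a′ ≤ b′ →
                     pairCode a b ≡ pairCode a′ b′ → a ≡ a′ × b ≡ b′
pairCode-injective {a} {b} {a′} {b′} a≤b a′≤b′ eq with <-cmp b b′
... | tri≈ _ refl _ = +-cancelˡ-≡ (triangle b) a a′ eq , refl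
... | tri< b<b′ _ _ = contradiction eq (<⇒≢ (<-≤-trans (pairCode-< a≤b b<b′) (m≤m+n _ a′)))
... | tri> _ _ b′<b = contradiction (sym eq) (<⇒≢ (<-≤-trans (pairCode-< a′≤b′ b′<b) (m≤m+n _ a)))

pairCode-diagonal≢ : ∀ a {a′ b′} → a′ < b′ → pairCode a a ≢ pairCode a′ b′
pairCode-diagonal≢ a a′<b′ eq with pairCode-injective {a} {a} ≤-refl (<⇒≤ a′<b′) eq
... | a≡a′ , a≡b′ = <-irrefl (trans (sym a≡a′) a≡b′) a′<b′

module MaximumClique {n : ℕ} (G : Graph n) (P₂∪P₄-free : Free P2∪P4 G)
  (butterfly-free : Free Butterfly G) (m : ℕ) (f : Vector (Fin n) (suc (suc m)))
  (f-clique : Adjacency.IsClique G f) (maxω : ∀ k → Clique G k → k ≤ suc (suc m)) where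

  open Adjacency G

  W : ℕ
  W = suc (suc m)

  clique-too-big : ∀ {q : Vector (Fin n) (suc W)} → ¬ IsClique q
  clique-too-big q-clique = 1+n≰n (maxω _ (toClique q-clique))

  S : Fin n → Set
  S u = u ≁ f 0F × u ≁ f 1F

  S? : Decidable S
  S? u = (adj G u (f 0F) ≟ᵇ false) ×-dec (adj G u (f 1F) ≟ᵇ false)

  open Greedy G S? (P₄-free-off-edge G P₂∪P₄-free (f-clique 0F 1F λ ()) (λ Sx → Sx))

  OnlyMisses : Fin n → Fin W → Set
  OnlyMisses u i = ∀ k → k ≢ i → u ~ f k

  FirstMisses : Fin n → Fin W → Fin W → Set
  FirstMisses u i j =
    toℕ i < toℕ j × u ≁ f i × u ≁ f j × (∀ k → toℕ k < toℕ j → k ≢ i → u ~ f k)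

  data Profile (u : Fin n) : Set where
    in-S         : S u → Profile u
    only-misses  : ∀ i → OnlyMisses u i → Profile u
    first-misses : ∀ i j → FirstMisses u i j → ¬ S u → Profile u

  sees-below : ∀ {u i} → (∀ k → toℕ k < toℕ i → u ~ f k) →
               ∀ k → toℕ k ≤ toℕ i ⊎ u ~ f k → k ≢ i → u ~ f k
  sees-below before-i k (inj₁ k≤i) k≢i = before-i k (≤∧≢⇒< k≤i (k≢i ∘ toℕ-injective))
  sees-below before-i k (inj₂ u~fk) _  = u~fk

  profile : ∀ u → Profile u
  profile u with S? u
  ... | yes Su = in-S Su
  ... | no ¬Su with least-failure (λ k → u ~? f k)
  ...   | inj₂ u~f = ⊥-elim (clique-too-big (∷-isClique f-clique u~f))
  ...   | inj₁ (i , ¬u~fi , before-i) with least-failure (λ k → (toℕ k ≤? toℕ i) ⊎-dec (u ~? f k))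
  ...     | inj₂ after-i = only-misses i λ k → sees-below before-i k (after-i k)
  ...     | inj₁ (j , j-fails , before-j) = first-misses i j
    ( ≰⇒> (j-fails ∘ inj₁) , ¬~⇒≁ ¬u~fi , ¬~⇒≁ (j-fails ∘ inj₂)
    , λ k k<j → sees-below before-i k (before-j k k<j) ) ¬Su

  -- S-colour 0 reuses the code of the pair (0, 1): every vertex missing f₀ and f₁ is in S.
  S-code : ℕ → ℕ
  S-code zero    = pairCode 0 1
  S-code (suc s) = triangle W + s

  code : ∀ u → Profile u → ℕ
  code u (in-S Su)              = S-code (colour u Su)
  code u (only-misses i _)      = pairCode (toℕ i) (toℕ i)
  code u (first-misses i j _ _) = pairCode (toℕ i) (toℕ j)

  K : ℕ
  K = triangle W + suc m

  S-code-zero<triangle : pairCode 0 1 < triangle W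
  S-code-zero<triangle = ≤-trans (s≤s (s≤s z≤n)) (triangle-mono {2} {W} (s≤s (s≤s z≤n)))

  S-code-< : ∀ {s} → s < W → S-code s < K
  S-code-< {zero}  _               = ≤-trans S-code-zero<triangle (m≤m+n _ _)
  S-code-< {suc s} (s≤s (s≤s s≤m)) = +-monoʳ-< (triangle W) (s≤s s≤m)

  code-< : ∀ u p → code u p < K
  code-< u (in-S Su)               = S-code-< (colour-< maxω (colour-∈ u Su))
  code-< u (only-misses i _)       = <-≤-trans (pairCode-< ≤-refl (toℕ<n i)) (m≤m+n _ _)
  code-< u (first-misses i j fm _) = <-≤-trans (pairCode-< (<⇒≤ (proj₁ fm)) (toℕ<n j)) (m≤m+n _ _)

  S-code-injective : ∀ s s′ → S-code s ≡ S-code s′ → s ≡ s′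
  S-code-injective zero    zero     _  = refl
  S-code-injective zero    (suc s′) eq =
    contradiction eq (<⇒≢ (<-≤-trans S-code-zero<triangle (m≤m+n _ s′)))
  S-code-injective (suc s) zero     eq =
    contradiction (sym eq) (<⇒≢ (<-≤-trans S-code-zero<triangle (m≤m+n _ s)))
  S-code-injective (suc s) (suc s′) eq = cong suc (+-cancelˡ-≡ (triangle W) s s′ eq)

  S-code≡pairCode : ∀ s {a b} → a ≤ b → b < W → S-code s ≡ pairCode a b → a ≡ 0 × b ≡ 1
  S-code≡pairCode zero    a≤b _   eq with pairCode-injective z≤n a≤b eq
  ... | 0≡a , 1≡b = sym 0≡a , sym 1≡b
  S-code≡pairCode (suc s) a≤b b<W eq =
    contradiction (sym eq) (<⇒≢ (<-≤-trans (pairCode-< a≤b b<W) (m≤m+n _ s)))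

  S-code≢diagonal : ∀ s (i : Fin W) → S-code s ≢ pairCode (toℕ i) (toℕ i)
  S-code≢diagonal s i eq with S-code≡pairCode s ≤-refl (toℕ<n i) eq
  ... | i≡0 , i≡1 = 0≢1+n (trans (sym i≡0) i≡1)

  misses-f₀-f₁⇒S : ∀ {w} (i j : Fin W) → toℕ i ≡ 0 → toℕ j ≡ 1 → w ≁ f i → w ≁ f j → S w
  misses-f₀-f₁⇒S 0F 1F _ _ w≁f₀ w≁f₁ = w≁f₀ , w≁f₁

  S-code≢firstMisses : ∀ s {w i j} → FirstMisses w i j → ¬ S w →
                       S-code s ≢ pairCode (toℕ i) (toℕ j)
  S-code≢firstMisses s {i = i} {j} (i<j , w≁fi , w≁fj , _) ¬Sw eq
    with S-code≡pairCode s (<⇒≤ i<j) (toℕ<n j) eq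
  ... | i≡0 , j≡1 = ¬Sw (misses-f₀-f₁⇒S i j i≡0 j≡1 w≁fi w≁fj)

  onlyMisses-independent : ∀ {u w} i → u ~ w → OnlyMisses u i → OnlyMisses w i → ⊥
  onlyMisses-independent {u} {w} i u~w u~f w~f =
    clique-too-big (∷-isClique (updateAt-isClique i f-clique w~f) u~swapped)
    where
    u~swapped : ∀ k → u ~ updateAt f i (const w) k
    u~swapped k with k ≟ᶠ i
    ... | yes refl rewrite updateAt-updates i {const w} f = u~w
    ... | no k≢i rewrite updateAt-minimal k i {const w} f k≢i = u~f k k≢i

  another-index : ∀ (i j : Fin W) → toℕ i < toℕ j → ¬ (toℕ i ≡ 0 × toℕ j ≡ 1) →
                  ∃ λ k → toℕ k < toℕ j × k ≢ i
  another-index (suc i) j i<j _ = 0F , ≤-<-trans z≤n i<j , λ ()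
  another-index 0F 1F _ not-0-1 = contradiction (refl , refl) not-0-1
  another-index 0F (suc (suc j)) _ _ = 1F , s≤s (s≤s z≤n) , λ ()

  firstMisses-independent : ∀ {u w i j} → u ~ w → ¬ S u → FirstMisses u i j → FirstMisses w i j → ⊥
  firstMisses-independent {i = i} {j} u~w ¬Su (i<j , u≁fi , u≁fj , u~f) (_ , w≁fi , w≁fj , w~f)
    with another-index i j i<j (λ (i≡0 , j≡1) → ¬Su (misses-f₀-f₁⇒S i j i≡0 j≡1 u≁fi u≁fj))
  ... | k , k<j , k≢i =
    ¬-induced-butterfly G butterfly-free (~-sym (u~f k k<j k≢i)) (~-sym (w~f k k<j k≢i)) u~w
      (f-clique k i k≢i) (f-clique k j (<⇒≢ᶠ k<j)) (f-clique i j (<⇒≢ᶠ i<j)) u≁fi u≁fj w≁fi w≁fj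

  code-proper : ∀ {u w} → u ~ w → (pu : Profile u) (pw : Profile w) → code u pu ≢ code w pw
  code-proper u~w (in-S Su) (in-S Sw) eq = colour-proper Su Sw u~w (S-code-injective _ _ eq)
  code-proper {u} _ (in-S Su) (only-misses i _) eq = S-code≢diagonal (colour u Su) i eq
  code-proper {u} _ (in-S Su) (first-misses i j fm ¬Sw) eq =
    S-code≢firstMisses (colour u Su) fm ¬Sw eq
  code-proper {w = w} _ (only-misses i _) (in-S Sw) eq = S-code≢diagonal (colour w Sw) i (sym eq)
  code-proper u~w (only-misses i om) (only-misses i′ om′) eq
    with toℕ-injective {i = i} {i′} (proj₁ (pairCode-injective {toℕ i} {toℕ i} ≤-refl ≤-refl eq))
  ... | refl = onlyMisses-independent i u~w om om′
  code-proper _ (only-misses i _) (first-misses i′ j′ fm _) eq =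
    pairCode-diagonal≢ (toℕ i) (proj₁ fm) eq
  code-proper {w = w} _ (first-misses i j fm ¬Su) (in-S Sw) eq =
    S-code≢firstMisses (colour w Sw) fm ¬Su (sym eq)
  code-proper _ (first-misses i j fm _) (only-misses i′ _) eq =
    pairCode-diagonal≢ (toℕ i′) (proj₁ fm) (sym eq)
  code-proper u~w (first-misses i j fm ¬Su) (first-misses i′ j′ fm′ _) eq
    with pairCode-injective (<⇒≤ (proj₁ fm)) (<⇒≤ (proj₁ fm′)) eq
  ... | i≡i′ , j≡j′ with toℕ-injective {i = i} {i′} i≡i′ | toℕ-injective {i = j} {j′} j≡j′
  ... | refl | refl = firstMisses-independent u~w ¬Su fm fm′

  colouring : Colouring G K
  colouring = (λ u → fromℕ< (code-< u (profile u))) , proper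
    where
    proper : ∀ u w → u ~ w → fromℕ< (code-< u (profile u)) ≢ fromℕ< (code-< w (profile w))
    proper u w u~w eq = code-proper u~w (profile u) (profile w)
      (trans (sym (toℕ-fromℕ< _)) (trans (cong toℕ eq) (toℕ-fromℕ< _)))

one-colouring : ∀ {n} (G : Graph n) → (∀ k → Clique G k → k ≤ 1) → Colouring G 1
one-colouring G maxω = (λ _ → 0F) , λ u v u~v _ →
  1+n≰n (maxω 2 (toClique (∷-isClique (singleton-isClique v) λ { 0F → u~v })))
  where open Adjacency G

colour-count : ∀ m → let W = suc (suc m) in 2 * (triangle W + suc m) + 2 ≡ W * W + 3 * W
colour-count m = begin
  2 * (triangle W + suc m) + 2      ≡⟨ cong (_+ 2) (*-distribˡ-+ 2 (triangle W) (suc m)) ⟩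
  2 * triangle W + 2 * suc m + 2    ≡⟨ cong (λ t → t + 2 * suc m + 2) (double-triangle W) ⟩
  W * W + W + 2 * suc m + 2         ≡⟨ regroup m ⟩
  W * W + 3 * W                     ∎
  where
  open ≡-Reasoning
  W : ℕ
  W = suc (suc m)
  regroup : ∀ m → let W = suc (suc m) in W * W + W + 2 * suc m + 2 ≡ W * W + 3 * W
  regroup = solve-∀

theorem1p2 : ∀ {n} (G : Graph n) → 1 ≤ n →
    Free P2∪P4 G → Free Butterfly G →
    ∀ χ ω → IsChromaticNumber G χ → IsCliqueNumber G ω →
    2 * χ + 2 ≤ ω * ω + 3 * ω
theorem1p2 G 1≤n _ _ χ zero _ (_ , maxω) =
  ⊥-elim (1+n≰n (maxω 1 (toClique (singleton-isClique (fromℕ< 1≤n)))))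
  where open Adjacency G
theorem1p2 G _ _ _ χ 1 (_ , minχ) (_ , maxω) =
  +-monoˡ-≤ 2 (*-monoʳ-≤ 2 (minχ 1 (one-colouring G maxω)))
theorem1p2 G _ P₂∪P₄-free butterfly-free χ (suc (suc m)) (_ , minχ) ((f , _ , f-clique) , maxω) =
  subst (2 * χ + 2 ≤_) (colour-count m) (+-monoˡ-≤ 2 (*-monoʳ-≤ 2 (minχ _ colouring)))
  where open MaximumClique G P₂∪P₄-free butterfly-free m f f-clique maxω
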